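{- Let $G$ be a connected graph of order $n$ with diameter $d\geq 4$. Then $m(-1)\leq n-5$.
   Context: For a connected graph $G$, $d(u,v)$ is the distance and $\varepsilon(v)=\max_u d(u,v)$ the eccentricity; the diameter is the maximum distance. The eccentricity matrix $\mathcal{A}(G)$ is indexed by $V(G)$ with $(u,v)$-entry $d(u,v)$ if $d(u,v)=\min\{\varepsilon(u),\varepsilon(v)\}$ and $0$ otherwise. $m(-1)$ is the multiplicity of $-1$ as an eigenvalue of $\mathcal{A}(G)$. -}

module Defs where

open import Data.Nat as ℕ using (ℕ; zero; suc; _≤_; _⊓_)
open import Data.Fin using (Fin; zero; suc)
open import Data.Integer using (+_)
open import Data.Rational using (ℚ; 0ℚ; _+_; _*_; _/_)
open import Data.Product using (Σ; ∃; ∃-syntax; _×_; _,_)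
open import Relation.Binary.PropositionalEquality using (_≡_; _≢_)
open import Relation.Nullary using (¬_)

record SimpleGraph (n : ℕ) : Set₁ where
  field
    Adj     : Fin n → Fin n → Set
    sym     : ∀ {u v} → Adj u v → Adj v u
    irrefl  : ∀ {u} → ¬ Adj u u
open SimpleGraph public

data Walk {n : ℕ} (G : SimpleGraph n) : Fin n → Fin n → ℕ → Set where
  nil  : ∀ {u} → Walk G u u 0
  cons : ∀ {u w v k} → Adj G u w → Walk G w v k → Walk G u v (suc k)

Connected : ∀ {n} → SimpleGraph n → Set
Connected G = ∀ u v → ∃[ k ] Walk G u v k

Dist : ∀ {n} → SimpleGraph n → Fin n → Fin n → ℕ → Set
Dist G u v k = Walk G u v k × (∀ j → Walk G u v j → k ≤ j)

Ecc : ∀ {n} → SimpleGraph n → Fin n → ℕ → Set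
Ecc {n} G u e = (∃[ v ] Dist G u v e) × (∀ (v : Fin n) k → Dist G u v k → k ≤ e)

Diameter : ∀ {n} → SimpleGraph n → ℕ → Set
Diameter {n} G d = (∃[ u ] ∃[ v ] Dist G u v d) × (∀ (u v : Fin n) k → Dist G u v k → k ≤ d)

ℕtoℚ : ℕ → ℚ
ℕtoℚ k = + k / 1

IsEccentricityMatrix : ∀ {n} → SimpleGraph n → (Fin n → Fin n → ℚ) → Set
IsEccentricityMatrix {n} G E =
  ∀ (u v : Fin n) (eu ev k : ℕ) → Ecc G u eu → Ecc G v ev → Dist G u v k →
    (k ≡ eu ⊓ ev → E u v ≡ ℕtoℚ k) × (k ≢ eu ⊓ ev → E u v ≡ 0ℚ)

∑ : ∀ {n} → (Fin n → ℚ) → ℚ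
∑ {zero}  f = 0ℚ
∑ {suc n} f = f zero + ∑ (λ i → f (suc i))

InEigenspace : ∀ {n} → (Fin n → Fin n → ℚ) → ℚ → (Fin n → ℚ) → Set
InEigenspace A λ' x = ∀ i → ∑ (λ j → A i j * x j) ≡ λ' * x i

LinIndep : ∀ {n k} → (Fin k → Fin n → ℚ) → Set
LinIndep {n} {k} xs =
  ∀ (c : Fin k → ℚ) → (∀ j → ∑ (λ i → c i * xs i j) ≡ 0ℚ) → ∀ i → c i ≡ 0ℚ

EigenspaceDimAtLeast : ∀ {n} → (Fin n → Fin n → ℚ) → ℚ → ℕ → Set
EigenspaceDimAtLeast {n} A λ' k =
  Σ (Fin k → Fin n → ℚ) λ xs → (∀ i → InEigenspace A λ' (xs i)) × LinIndep xs

-- m_A(λ) ≤ m : the eigenspace dimension (= multiplicity, A symmetric) is at most m.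
MultiplicityAtMost : ∀ {n} → (Fin n → Fin n → ℚ) → ℚ → ℕ → Set
MultiplicityAtMost A λ' m = ∀ k → EigenspaceDimAtLeast A λ' k → k ≤ m

-- Let v₀ v₁ v₂ ⋯ v_{d-1} v_d be a diametral path. Among these five vertices the eccentricity
-- matrix vanishes except at (v₀,v₂), (v₀,v_{d-1}), (v₁,v_d), (v₂,v_d) and (v₀,v_d), where it is
-- w ∈ {0, 2}, x, y ∈ {0, d - 1}, u ∈ {0, d - 2} and d (w = 2 only when d = 4). Eliminating
-- (M + I) g = 0 for this principal submatrix M leaves a symmetric 2 × 2 system of determinant
-- (1 - w² - x²)(1 - y² - u²) - (d - wu)², which is nonzero in every case, so -1 is not an
-- eigenvalue of M. Hence no nonzero combination of the standard basis vectors at these five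
-- vertices is a (-1)-eigenvector, and the (-1)-eigenspace has dimension at most n - 5.
module Submission where

open import Algebra.Bundles using (CommutativeMonoid; Ring)
open import Data.Fin as Fin using (Fin; zero; suc; punchIn; _↑ˡ_; _↑ʳ_; splitAt)
open import Data.Fin.Patterns using (0F; 1F; 2F; 3F; 4F)
import Data.Fin.Properties as Finₚ
import Data.Integer as ℤ
import Data.Integer.Properties as ℤₚ
open import Data.List using (List) renaming (_∷_ to _,ₗ_; [] to []ₗ)
open import Data.Nat as ℕ using (ℕ; zero; suc; z≤n; s≤s; _⊓_; _∸_)
import Data.Nat.Properties as ℕₚ
import Data.Nat.Tactic.RingSolver as ℕ-Solver
open import Data.Product using (∃; _×_; _,_; proj₁; proj₂)
open import Data.Rational as ℚ using (ℚ; 0ℚ; 1ℚ; _+_; _*_; _-_; -_; 1/_)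
import Data.Rational.Properties as ℚₚ
open import Data.Rational.Unnormalised as ℚᵘ using (ℚᵘ; mkℚᵘ; *≡*) renaming (_≃_ to _≃ᵘ_)
import Data.Rational.Unnormalised.Properties as ℚᵘₚ
open import Data.Sum using (_⊎_; inj₁; inj₂; map₂)
open import Data.Vec.Functional using (_++_; _∷_; []; insertAt; removeAt)
open import Data.Vec.Functional.Properties using (insertAt-lookup; insertAt-punchIn; lookup-++ˡ; lookup-++ʳ)
open import Defs renaming (sym to Adj-sym)
open import Effect.Monad using (RawMonad)
open import Function using (_∘_; flip; Injective)
open import Level using (0ℓ)
open import Relation.Binary.PropositionalEquality
open import Relation.Nullary using (¬_; yes; no; ¬?)
open import Relation.Nullary.Decidable using (dec⇒maybe; decidable-stable; ¬¬-excluded-middle)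
open import Relation.Nullary.Negation using (contradiction; ¬¬-Monad)
open import Tactic.RingSolver using (solve-∀; solve)
open import Tactic.RingSolver.Core.AlmostCommutativeRing using (AlmostCommutativeRing; fromCommutativeRing)

open import Algebra.Properties.Semiring.Sum (Ring.semiring ℚₚ.+-*-ring)
  using (sum; sum-cong-≗; sum-replicate-zero; ∑-distrib-+; *-distribˡ-sum; ∑-comm; sum-remove)
open import Algebra.Properties.Group ℚₚ.+-0-group using (x∙y⁻¹≈ε⇒x≈y)
open import Algebra.Properties.CommutativeSemigroup
  (CommutativeMonoid.commutativeSemigroup ℚₚ.*-1-commutativeMonoid) using (x∙yz≈y∙xz)

-- Linear algebra over ℚ

private
  ℚ-ring : AlmostCommutativeRing 0ℓ 0ℓ
  ℚ-ring = fromCommutativeRing ℚₚ.+-*-commutativeRing (λ p → dec⇒maybe (0ℚ ℚₚ.≟ p))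

∑≡sum : ∀ {n} (f : Fin n → ℚ) → ∑ f ≡ sum f
∑≡sum {zero}  f = refl
∑≡sum {suc n} f = cong (f zero +_) (∑≡sum (f ∘ suc))

∑-cong : ∀ {n} {f g : Fin n → ℚ} → (∀ i → f i ≡ g i) → ∑ f ≡ ∑ g
∑-cong {f = f} {g} f≗g = trans (∑≡sum f) (trans (sum-cong-≗ {x = f} {y = g} f≗g) (sym (∑≡sum g)))

∑-zero : ∀ n → ∑ {n} (λ _ → 0ℚ) ≡ 0ℚ
∑-zero n = trans (∑≡sum {n} (λ _ → 0ℚ)) (sum-replicate-zero n)

∑-+ : ∀ {n} (f g : Fin n → ℚ) → ∑ (λ i → f i + g i) ≡ ∑ f + ∑ g
∑-+ f g = trans (∑≡sum (λ i → f i + g i)) (trans (∑-distrib-+ f g) (sym (cong₂ _+_ (∑≡sum f) (∑≡sum g))))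

*-∑ : ∀ {n} a (f : Fin n → ℚ) → a * ∑ f ≡ ∑ (λ i → a * f i)
*-∑ a f = trans (cong (a *_) (∑≡sum f)) (trans (*-distribˡ-sum a f) (sym (∑≡sum (λ i → a * f i))))

∑-swap : ∀ {m n} (f : Fin m → Fin n → ℚ) → ∑ (λ i → ∑ (f i)) ≡ ∑ (λ j → ∑ (λ i → f i j))
∑-swap f = begin
  ∑ (λ i → ∑ (f i))               ≡⟨ ∑-cong (λ i → ∑≡sum (f i)) ⟩
  ∑ (λ i → sum (f i))             ≡⟨ ∑≡sum (λ i → sum (f i)) ⟩
  sum (λ i → sum (f i))           ≡⟨ ∑-comm f ⟩
  sum (λ j → sum (λ i → f i j))   ≡⟨ ∑≡sum (λ j → sum (λ i → f i j)) ⟨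
  ∑ (λ j → sum (λ i → f i j))     ≡⟨ ∑-cong (λ j → ∑≡sum (λ i → f i j)) ⟨
  ∑ (λ j → ∑ (λ i → f i j))       ∎
  where open ≡-Reasoning

∑-remove : ∀ {n} (p : Fin (suc n)) (f : Fin (suc n) → ℚ) → ∑ f ≡ f p + ∑ (removeAt f p)
∑-remove p f = trans (∑≡sum f) (trans (sum-remove f) (cong (f p +_) (sym (∑≡sum (removeAt f p)))))

basis : ∀ {n} → Fin n → Fin n → ℚ
basis v j with v Fin.≟ j
... | yes _ = 1ℚ
... | no  _ = 0ℚ

basis-diagonal : ∀ {n} (v : Fin n) → basis v v ≡ 1ℚ
basis-diagonal v with v Fin.≟ v
... | yes _   = refl
... | no  v≢v = contradiction refl v≢v

basis-offDiagonal : ∀ {n} {v j : Fin n} → v ≢ j → basis v j ≡ 0ℚ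
basis-offDiagonal {v = v} {j} v≢j with v Fin.≟ j
... | yes v≡j = contradiction v≡j v≢j
... | no  _   = refl

∑-*-basis : ∀ {n} (f : Fin n → ℚ) (v : Fin n) → ∑ (λ j → f j * basis v j) ≡ f v
∑-*-basis {suc n} f v = begin
  ∑ (λ j → f j * basis v j)                               ≡⟨ ∑-remove v (λ j → f j * basis v j) ⟩
  f v * basis v v + ∑ (λ i → f (punchIn v i) * basis v (punchIn v i))
    ≡⟨ cong₂ _+_ (cong (f v *_) (basis-diagonal v)) (∑-cong vanish) ⟩
  f v * 1ℚ + ∑ {n} (λ _ → 0ℚ)                             ≡⟨ cong₂ _+_ (ℚₚ.*-identityʳ (f v)) (∑-zero n) ⟩
  f v + 0ℚ                                                ≡⟨ ℚₚ.+-identityʳ (f v) ⟩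
  f v                                                     ∎
  where
  open ≡-Reasoning
  vanish : ∀ i → f (punchIn v i) * basis v (punchIn v i) ≡ 0ℚ
  vanish i = trans (cong (f (punchIn v i) *_) (basis-offDiagonal (Finₚ.punchInᵢ≢i v i ∘ sym)))
                   (ℚₚ.*-zeroʳ (f (punchIn v i)))

lincomb : ∀ {k n} → (Fin k → ℚ) → (Fin k → Fin n → ℚ) → Fin n → ℚ
lincomb c xs j = ∑ (λ i → c i * xs i j)

lincomb-zeroColumn : ∀ {k n} (c : Fin k → ℚ) (xs : Fin k → Fin n → ℚ) j →
                     (∀ i → xs i j ≡ 0ℚ) → lincomb c xs j ≡ 0ℚ
lincomb-zeroColumn {k} c xs j col≡0 =
  trans (∑-cong (λ i → trans (cong (c i *_) (col≡0 i)) (ℚₚ.*-zeroʳ (c i)))) (∑-zero k)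

∑-*-lincomb : ∀ {k n} (a : Fin n → ℚ) (c : Fin k → ℚ) (xs : Fin k → Fin n → ℚ) →
              ∑ (λ j → a j * lincomb c xs j) ≡ ∑ (λ i → c i * ∑ (λ j → a j * xs i j))
∑-*-lincomb a c xs = begin
  ∑ (λ j → a j * lincomb c xs j)                ≡⟨ ∑-cong (λ j → *-∑ (a j) (λ i → c i * xs i j)) ⟩
  ∑ (λ j → ∑ (λ i → a j * (c i * xs i j)))      ≡⟨ ∑-swap (λ j i → a j * (c i * xs i j)) ⟩
  ∑ (λ i → ∑ (λ j → a j * (c i * xs i j)))
    ≡⟨ ∑-cong (λ i → ∑-cong (λ j → x∙yz≈y∙xz (a j) (c i) (xs i j))) ⟩
  ∑ (λ i → ∑ (λ j → c i * (a j * xs i j)))      ≡⟨ ∑-cong (λ i → *-∑ (c i) (λ j → a j * xs i j)) ⟨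
  ∑ (λ i → c i * ∑ (λ j → a j * xs i j))        ∎
  where open ≡-Reasoning

lincomb-inEigenspace : ∀ {k n} (A : Fin n → Fin n → ℚ) λ' {xs : Fin k → Fin n → ℚ} →
                       (∀ i → InEigenspace A λ' (xs i)) → ∀ c → InEigenspace A λ' (lincomb c xs)
lincomb-inEigenspace A λ' {xs} eig c r = begin
  ∑ (λ j → A r j * lincomb c xs j)              ≡⟨ ∑-*-lincomb (A r) c xs ⟩
  ∑ (λ i → c i * ∑ (λ j → A r j * xs i j))      ≡⟨ ∑-cong (λ i → cong (c i *_) (eig i r)) ⟩
  ∑ (λ i → c i * (λ' * xs i r))                 ≡⟨ ∑-cong (λ i → x∙yz≈y∙xz (c i) λ' (xs i r)) ⟩
  ∑ (λ i → λ' * (c i * xs i r))                 ≡⟨ *-∑ λ' (λ i → c i * xs i r) ⟨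
  λ' * lincomb c xs r                           ∎
  where open ≡-Reasoning

inEigenspace-opposite : ∀ {n} (A : Fin n → Fin n → ℚ) λ' {z u : Fin n → ℚ} →
                        InEigenspace A λ' z → (∀ j → z j + u j ≡ 0ℚ) → InEigenspace A λ' u
inEigenspace-opposite {n} A λ' {z} {u} z-eig z+u≡0 r = opposite (z+u≡0 r) (begin
  λ' * z r + ∑ (λ j → A r j * u j)               ≡⟨ cong (_+ ∑ (λ j → A r j * u j)) (z-eig r) ⟨
  ∑ (λ j → A r j * z j) + ∑ (λ j → A r j * u j)  ≡⟨ ∑-+ (λ j → A r j * z j) (λ j → A r j * u j) ⟨
  ∑ (λ j → A r j * z j + A r j * u j)
    ≡⟨ ∑-cong (λ j → sym (ℚₚ.*-distribˡ-+ (A r j) (z j) (u j))) ⟩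
  ∑ (λ j → A r j * (z j + u j))
    ≡⟨ ∑-cong (λ j → trans (cong (A r j *_) (z+u≡0 j)) (ℚₚ.*-zeroʳ (A r j))) ⟩
  ∑ {n} (λ _ → 0ℚ)                               ≡⟨ ∑-zero n ⟩
  0ℚ                                             ∎)
  where
  open ≡-Reasoning
  opposite : ∀ {x y b} → x + y ≡ 0ℚ → λ' * x + b ≡ 0ℚ → b ≡ λ' * y
  opposite {x} {y} {b} x+y≡0 λx+b≡0 = begin
    b                                     ≡⟨ regroup λ' x y b ⟩
    (λ' * x + b) - λ' * (x + y) + λ' * y  ≡⟨ cong₂ (λ s t → s - λ' * t + λ' * y) λx+b≡0 x+y≡0 ⟩
    0ℚ - λ' * 0ℚ + λ' * y                 ≡⟨ collapse λ' y ⟩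
    λ' * y                                ∎
    where
    regroup : ∀ l x y b → b ≡ (l * x + b) - l * (x + y) + l * y
    regroup = solve-∀ ℚ-ring
    collapse : ∀ l y → 0ℚ - l * 0ℚ + l * y ≡ l * y
    collapse = solve-∀ ℚ-ring

linIndep-tail : ∀ {k n} (xs : Fin k → Fin (suc n) → ℚ) → (∀ i → xs i zero ≡ 0ℚ) →
                LinIndep xs → LinIndep (λ i j → xs i (suc j))
linIndep-tail xs col₀≡0 li c rel = li c λ where
  zero    → lincomb-zeroColumn c xs zero col₀≡0
  (suc j) → rel j

module Elimination {k n} (xs : Fin (suc k) → Fin (suc n) → ℚ) (p : Fin (suc k))
                   (xₚ≢0 : xs p zero ≢ 0ℚ) where
  private instance _ = ℚ.≢-nonZero xₚ≢0

  ratio : Fin k → ℚ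
  ratio i = xs (punchIn p i) zero * 1/ xs p zero

  eliminate : Fin k → Fin (suc n) → ℚ
  eliminate i j = xs (punchIn p i) j - ratio i * xs p j

  eliminate-zero : ∀ i → eliminate i zero ≡ 0ℚ
  eliminate-zero i = begin
    x - x * 1/ a * a    ≡⟨ cong (λ y → x - y) (ℚₚ.*-assoc x (1/ a) a) ⟩
    x - x * (1/ a * a)  ≡⟨ cong (λ y → x - x * y) (ℚₚ.*-inverseˡ a) ⟩
    x - x * 1ℚ          ≡⟨ cancel x ⟩
    0ℚ                  ∎
    where
    open ≡-Reasoning
    x a : ℚ
    x = xs (punchIn p i) zero
    a = xs p zero
    cancel : ∀ x → x - x * 1ℚ ≡ 0ℚ
    cancel = solve-∀ ℚ-ring

  lincomb-insertAt : ∀ (c : Fin k → ℚ) j →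
    lincomb (insertAt c p (- ∑ (λ i → c i * ratio i))) xs j ≡ lincomb c eliminate j
  lincomb-insertAt c j = begin
    lincomb c′ xs j                                          ≡⟨ ∑-remove p (λ q → c′ q * xs q j) ⟩
    c′ p * xs p j + ∑ (λ i → c′ (punchIn p i) * xs (punchIn p i) j)
      ≡⟨ cong₂ (λ β d → β * xs p j + d) (insertAt-lookup c p β)
               (∑-cong (λ i → cong (_* xs (punchIn p i) j) (insertAt-punchIn c p β i))) ⟩
    β * xs p j + lincomb c (removeAt xs p) j                 ≡⟨ shear S (xs p j) _ ⟩
    lincomb c (removeAt xs p) j + (- xs p j) * S
      ≡⟨ cong (lincomb c (removeAt xs p) j +_) (*-∑ (- xs p j) (λ i → c i * ratio i)) ⟩
    lincomb c (removeAt xs p) j + ∑ (λ i → (- xs p j) * (c i * ratio i))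
      ≡⟨ ∑-+ (λ i → c i * xs (punchIn p i) j) (λ i → (- xs p j) * (c i * ratio i)) ⟨
    ∑ (λ i → c i * xs (punchIn p i) j + (- xs p j) * (c i * ratio i))
      ≡⟨ ∑-cong (λ i → distribute (c i) (xs (punchIn p i) j) (ratio i) (xs p j)) ⟩
    lincomb c eliminate j                                    ∎
    where
    open ≡-Reasoning
    S β : ℚ
    S = ∑ (λ i → c i * ratio i)
    β = - S
    c′ : Fin (suc k) → ℚ
    c′ = insertAt c p β
    shear : ∀ S X L → (- S) * X + L ≡ L + (- X) * S
    shear = solve-∀ ℚ-ring
    distribute : ∀ c x r X → c * x + (- X) * (c * r) ≡ c * (x - r * X)
    distribute = solve-∀ ℚ-ring

  linIndep-eliminate : LinIndep xs → LinIndep (λ i j → eliminate i (suc j))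
  linIndep-eliminate li c rel i = begin
    c i                          ≡⟨ insertAt-punchIn c p β i ⟨
    insertAt c p β (punchIn p i) ≡⟨ li (insertAt c p β) relation (punchIn p i) ⟩
    0ℚ                           ∎
    where
    open ≡-Reasoning
    β : ℚ
    β = - ∑ (λ i → c i * ratio i)
    relation : ∀ j → lincomb (insertAt c p β) xs j ≡ 0ℚ
    relation j = trans (lincomb-insertAt c j) (column j)
      where
      column : ∀ j → lincomb c eliminate j ≡ 0ℚ
      column zero    = lincomb-zeroColumn c eliminate zero eliminate-zero
      column (suc j) = rel j

linIndep⇒k≤n : ∀ {k n} (xs : Fin k → Fin n → ℚ) → LinIndep xs → k ℕ.≤ n
linIndep⇒k≤n {zero}          _  _  = z≤n
linIndep⇒k≤n {suc k} {zero}  xs li = contradiction (li (λ _ → 1ℚ) (λ ()) zero) λ ()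
linIndep⇒k≤n {suc k} {suc n} xs li with Finₚ.any? (λ i → ¬? (xs i zero ℚₚ.≟ 0ℚ))
... | yes (p , xₚ≢0) = s≤s (linIndep⇒k≤n (λ i j → eliminate i (suc j)) (linIndep-eliminate li))
  where open Elimination xs p xₚ≢0
... | no ∄pivot = ℕₚ.m≤n⇒m≤1+n (linIndep⇒k≤n (λ i j → xs i (suc j)) (linIndep-tail xs col₀≡0 li))
  where
  col₀≡0 : ∀ i → xs i zero ≡ 0ℚ
  col₀≡0 i = decidable-stable (xs i zero ℚₚ.≟ 0ℚ) (λ xᵢ≢0 → ∄pivot (i , xᵢ≢0))

∑-splitAt : ∀ {k m} (f : Fin (k ℕ.+ m) → ℚ) → ∑ f ≡ ∑ (λ i → f (i ↑ˡ m)) + ∑ (λ q → f (k ↑ʳ q))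
∑-splitAt {zero}  f = sym (ℚₚ.+-identityˡ (∑ f))
∑-splitAt {suc k} {m} f =
  trans (cong (f zero +_) (∑-splitAt {k} {m} (f ∘ suc))) (sym (ℚₚ.+-assoc (f zero) _ _))

lincomb-++ : ∀ {k m n} (γ : Fin (k ℕ.+ m) → ℚ) (xs : Fin k → Fin n → ℚ) (ys : Fin m → Fin n → ℚ) j →
             lincomb γ (xs ++ ys) j ≡ lincomb (λ i → γ (i ↑ˡ m)) xs j + lincomb (λ q → γ (k ↑ʳ q)) ys j
lincomb-++ {k} {m} γ xs ys j = trans (∑-splitAt {k} {m} (λ i → γ i * (xs ++ ys) i j)) (cong₂ _+_
  (∑-cong (λ i → cong (λ v → γ (i ↑ˡ m) * v j) (lookup-++ˡ xs ys i)))
  (∑-cong (λ q → cong (λ v → γ (k ↑ʳ q) * v j) (lookup-++ʳ xs ys q))))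

lincomb-zeroCoefficients : ∀ {k n} (c : Fin k → ℚ) (xs : Fin k → Fin n → ℚ) j →
                           (∀ i → c i ≡ 0ℚ) → lincomb c xs j ≡ 0ℚ
lincomb-zeroCoefficients {k} c xs j c≡0 =
  trans (∑-cong (λ i → trans (cong (_* xs i j) (c≡0 i)) (ℚₚ.*-zeroˡ (xs i j)))) (∑-zero k)

linIndep-++ : ∀ {k m n} {xs : Fin k → Fin n → ℚ} {ys : Fin m → Fin n → ℚ} → LinIndep xs →
              (∀ c g → (∀ j → lincomb c xs j + lincomb g ys j ≡ 0ℚ) → ∀ q → g q ≡ 0ℚ) →
              LinIndep (xs ++ ys)
linIndep-++ {k} {m} {xs = xs} {ys} li-xs trivial-ys γ rel i =
  subst (λ i → γ i ≡ 0ℚ) (Finₚ.join-splitAt k m i) (γ≡0 (splitAt k i))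
  where
  c : Fin k → ℚ
  c i = γ (i ↑ˡ m)
  g : Fin m → ℚ
  g q = γ (k ↑ʳ q)
  rel′ : ∀ j → lincomb c xs j + lincomb g ys j ≡ 0ℚ
  rel′ j = trans (sym (lincomb-++ γ xs ys j)) (rel j)
  g≡0 : ∀ q → g q ≡ 0ℚ
  g≡0 = trivial-ys c g rel′
  c≡0 : ∀ i → c i ≡ 0ℚ
  c≡0 = li-xs c λ j → begin
    lincomb c xs j                   ≡⟨ ℚₚ.+-identityʳ _ ⟨
    lincomb c xs j + 0ℚ              ≡⟨ cong (lincomb c xs j +_) (lincomb-zeroCoefficients g ys j g≡0) ⟨
    lincomb c xs j + lincomb g ys j  ≡⟨ rel′ j ⟩
    0ℚ                               ∎
    where open ≡-Reasoning
  γ≡0 : ∀ s → γ (Fin.join k m s) ≡ 0ℚ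
  γ≡0 (inj₁ i) = c≡0 i
  γ≡0 (inj₂ q) = g≡0 q

module _ {m n} {vs : Fin m → Fin n} (vs-injective : Injective _≡_ _≡_ vs) where

  lincomb-basis : ∀ (g : Fin m → ℚ) q → lincomb g (basis ∘ vs) (vs q) ≡ g q
  lincomb-basis g q = trans (∑-cong (λ i → cong (g i *_) (reindex i))) (∑-*-basis g q)
    where
    reindex : ∀ i → basis (vs i) (vs q) ≡ basis q i
    reindex i with i Fin.≟ q
    ... | yes refl = trans (basis-diagonal (vs i)) (sym (basis-diagonal i))
    ... | no  i≢q  = trans (basis-offDiagonal (i≢q ∘ vs-injective)) (sym (basis-offDiagonal (i≢q ∘ sym)))

  ∑-*-lincomb-basis : ∀ (a : Fin n → ℚ) (g : Fin m → ℚ) →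
                      ∑ (λ j → a j * lincomb g (basis ∘ vs) j) ≡ ∑ (λ q → a (vs q) * g q)
  ∑-*-lincomb-basis a g = begin
    ∑ (λ j → a j * lincomb g (basis ∘ vs) j)      ≡⟨ ∑-*-lincomb a g (basis ∘ vs) ⟩
    ∑ (λ q → g q * ∑ (λ j → a j * basis (vs q) j)) ≡⟨ ∑-cong (λ q → cong (g q *_) (∑-*-basis a (vs q))) ⟩
    ∑ (λ q → g q * a (vs q))                       ≡⟨ ∑-cong (λ q → ℚₚ.*-comm (g q) (a (vs q))) ⟩
    ∑ (λ q → a (vs q) * g q)                       ∎
    where open ≡-Reasoning

  -- The basis vectors at vs extend any independent family of λ-eigenvectors.
  eigenspaceDim+m≤n : ∀ (A : Fin n → Fin n → ℚ) λ' →
    (∀ g → InEigenspace (λ i j → A (vs i) (vs j)) λ' g → ∀ q → g q ≡ 0ℚ) →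
    ∀ {k} → EigenspaceDimAtLeast A λ' k → k ℕ.+ m ℕ.≤ n
  eigenspaceDim+m≤n A λ' principal-regular (xs , eig , li) =
    linIndep⇒k≤n (xs ++ basis ∘ vs) (linIndep-++ li trivial)
    where
    trivial : ∀ c g → (∀ j → lincomb c xs j + lincomb g (basis ∘ vs) j ≡ 0ℚ) → ∀ q → g q ≡ 0ℚ
    trivial c g rel = principal-regular g λ q′ → begin
      ∑ (λ q → A (vs q′) (vs q) * g q)                ≡⟨ ∑-*-lincomb-basis (A (vs q′)) g ⟨
      ∑ (λ j → A (vs q′) j * lincomb g (basis ∘ vs) j) ≡⟨ u-eig (vs q′) ⟩
      λ' * lincomb g (basis ∘ vs) (vs q′)             ≡⟨ cong (λ' *_) (lincomb-basis g q′) ⟩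
      λ' * g q′                                       ∎
      where
      open ≡-Reasoning
      u-eig : InEigenspace A λ' (lincomb g (basis ∘ vs))
      u-eig = inEigenspace-opposite A λ' (lincomb-inEigenspace A λ' eig c) rel

-- The principal submatrix on a diametral path

p*q≡0⇒q≡0 : ∀ {p q} → p ≢ 0ℚ → p * q ≡ 0ℚ → q ≡ 0ℚ
p*q≡0⇒q≡0 {p} {q} p≢0 pq≡0 = begin
  q               ≡⟨ ℚₚ.*-identityˡ q ⟨
  1ℚ * q          ≡⟨ cong (_* q) (ℚₚ.*-inverseˡ p) ⟨
  1/ p * p * q    ≡⟨ ℚₚ.*-assoc (1/ p) p q ⟩
  1/ p * (p * q)  ≡⟨ cong (1/ p *_) pq≡0 ⟩
  1/ p * 0ℚ       ≡⟨ ℚₚ.*-zeroʳ (1/ p) ⟩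
  0ℚ              ∎
  where
  open ≡-Reasoning
  instance _ = ℚ.≢-nonZero p≢0

private
  vanish₂ : ∀ {s t} α β → s ≡ 0ℚ → t ≡ 0ℚ → α * s - β * t ≡ 0ℚ
  vanish₂ α β refl refl = solve (α ,ₗ β ,ₗ []ₗ) ℚ-ring

  vanish₃ : ∀ {s t v} β γ → s ≡ 0ℚ → t ≡ 0ℚ → v ≡ 0ℚ → s - β * t - γ * v ≡ 0ℚ
  vanish₃ β γ refl refl refl = solve (β ,ₗ γ ,ₗ []ₗ) ℚ-ring

symmetric2×2-regular : ∀ a b c {p q} → a * c - b * b ≢ 0ℚ →
                       a * p + b * q ≡ 0ℚ → b * p + c * q ≡ 0ℚ → p ≡ 0ℚ × q ≡ 0ℚ
symmetric2×2-regular a b c {p} {q} det≢0 row₁ row₂ =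
  p*q≡0⇒q≡0 det≢0 (trans (cramer₁ a b c p q) (vanish₂ c b row₁ row₂)) ,
  p*q≡0⇒q≡0 det≢0 (trans (cramer₂ a b c p q) (vanish₂ a b row₂ row₁))
  where
  cramer₁ : ∀ a b c p q → (a * c - b * b) * p ≡ c * (a * p + b * q) - b * (b * p + c * q)
  cramer₁ = solve-∀ ℚ-ring
  cramer₂ : ∀ a b c p q → (a * c - b * b) * q ≡ a * (b * p + c * q) - b * (a * p + b * q)
  cramer₂ = solve-∀ ℚ-ring

-- The eccentricity matrix on the vertices at positions 0, 1, 2, d - 1, d of a diametral path.
pathMatrix : (w x y u δ : ℚ) → Fin 5 → Fin 5 → ℚ
pathMatrix w x y u δ =
    (0ℚ ∷ 0ℚ ∷ w  ∷ x  ∷ δ  ∷ [])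
  ∷ (0ℚ ∷ 0ℚ ∷ 0ℚ ∷ 0ℚ ∷ y  ∷ [])
  ∷ (w  ∷ 0ℚ ∷ 0ℚ ∷ 0ℚ ∷ u  ∷ [])
  ∷ (x  ∷ 0ℚ ∷ 0ℚ ∷ 0ℚ ∷ 0ℚ ∷ [])
  ∷ (δ  ∷ y  ∷ u  ∷ 0ℚ ∷ 0ℚ ∷ [])
  ∷ []

pathDet : (w x y u δ : ℚ) → ℚ
pathDet w x y u δ = (1ℚ - w * w - x * x) * (1ℚ - y * y - u * u) - (δ - w * u) * (δ - w * u)

private
  -- Gaussian elimination of (pathMatrix + I) g = 0 down to a symmetric 2 × 2 system in g₀, g₄;
  -- the rows rᵢ are written the way ∑ unfolds them.
  pathRows : ∀ (w x y u δ g₀ g₁ g₂ g₃ g₄ : ℚ) →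
    let row : (m₀ m₁ m₂ m₃ m₄ gᵢ : ℚ) → ℚ
        row m₀ m₁ m₂ m₃ m₄ gᵢ = m₀ * g₀ + (m₁ * g₁ + (m₂ * g₂ + (m₃ * g₃ + (m₄ * g₄ + 0ℚ)))) - - 1ℚ * gᵢ
        r₀ = row 0ℚ 0ℚ w  x  δ  g₀
        r₁ = row 0ℚ 0ℚ 0ℚ 0ℚ y  g₁
        r₂ = row w  0ℚ 0ℚ 0ℚ u  g₂
        r₃ = row x  0ℚ 0ℚ 0ℚ 0ℚ g₃
        r₄ = row δ  y  u  0ℚ 0ℚ g₄
    in ((1ℚ - w * w - x * x) * g₀ + (δ - w * u) * g₄ ≡ r₀ - w * r₂ - x * r₃)
     × ((δ - w * u) * g₀ + (1ℚ - y * y - u * u) * g₄ ≡ r₄ - y * r₁ - u * r₂)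
     × (g₁ ≡ 1ℚ * r₁ - y * g₄)
     × (g₂ ≡ r₂ - w * g₀ - u * g₄)
     × (g₃ ≡ 1ℚ * r₃ - x * g₀)
  pathRows w x y u δ g₀ g₁ g₂ g₃ g₄ =
    solve vars ℚ-ring , solve vars ℚ-ring , solve vars ℚ-ring , solve vars ℚ-ring , solve vars ℚ-ring
    where
    vars : List ℚ
    vars = w ,ₗ x ,ₗ y ,ₗ u ,ₗ δ ,ₗ g₀ ,ₗ g₁ ,ₗ g₂ ,ₗ g₃ ,ₗ g₄ ,ₗ []ₗ

pathMatrix-regular : ∀ {w x y u δ} → pathDet w x y u δ ≢ 0ℚ →
                     ∀ g → InEigenspace (pathMatrix w x y u δ) (- 1ℚ) g → ∀ i → g i ≡ 0ℚ
pathMatrix-regular {w} {x} {y} {u} {δ} det≢0 g eig =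
  let (row₀ , row₄ , row₁ , row₂ , row₃) = pathRows w x y u δ (g 0F) (g 1F) (g 2F) (g 3F) (g 4F)
      (g₀≡0 , g₄≡0) = symmetric2×2-regular (1ℚ - w * w - x * x) (δ - w * u) (1ℚ - y * y - u * u) det≢0
                        (trans row₀ (vanish₃ w x (r≡0 0F) (r≡0 2F) (r≡0 3F)))
                        (trans row₄ (vanish₃ y u (r≡0 4F) (r≡0 1F) (r≡0 2F)))
  in λ where
       0F → g₀≡0
       1F → trans row₁ (vanish₂ 1ℚ y (r≡0 1F) g₄≡0)
       2F → trans row₂ (vanish₃ w u (r≡0 2F) g₀≡0 g₄≡0)
       3F → trans row₃ (vanish₂ 1ℚ x (r≡0 3F) g₀≡0)
       4F → g₄≡0
  where
  r≡0 : ∀ i → ∑ (λ j → pathMatrix w x y u δ i j * g j) - - 1ℚ * g i ≡ 0ℚ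
  r≡0 i = trans (cong (_- - 1ℚ * g i) (eig i)) (ℚₚ.+-inverseʳ (- 1ℚ * g i))

private
  ℕtoℚᵘ : ℕ → ℚᵘ
  ℕtoℚᵘ k = mkℚᵘ (ℤ.+ k) 0

  toℚᵘ-ℕtoℚ : ∀ k → ℚ.toℚᵘ (ℕtoℚ k) ≃ᵘ ℕtoℚᵘ k
  toℚᵘ-ℕtoℚ k = ℚₚ.toℚᵘ-fromℚᵘ (ℕtoℚᵘ k)

ℕtoℚ-+ : ∀ m n → ℕtoℚ (m ℕ.+ n) ≡ ℕtoℚ m + ℕtoℚ n
ℕtoℚ-+ m n = ℚₚ.toℚᵘ-injective (begin
  ℚ.toℚᵘ (ℕtoℚ (m ℕ.+ n))                   ≈⟨ toℚᵘ-ℕtoℚ (m ℕ.+ n) ⟩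
  ℕtoℚᵘ (m ℕ.+ n)
    ≈⟨ *≡* (cong (ℤ._* ℤ.+ 1) (trans (ℤₚ.pos-+ m n)
         (sym (cong₂ ℤ._+_ (ℤₚ.*-identityʳ (ℤ.+ m)) (ℤₚ.*-identityʳ (ℤ.+ n)))))) ⟩
  ℕtoℚᵘ m ℚᵘ.+ ℕtoℚᵘ n                      ≈⟨ ℚᵘₚ.+-cong (toℚᵘ-ℕtoℚ m) (toℚᵘ-ℕtoℚ n) ⟨
  ℚ.toℚᵘ (ℕtoℚ m) ℚᵘ.+ ℚ.toℚᵘ (ℕtoℚ n)       ≈⟨ ℚₚ.toℚᵘ-homo-+ (ℕtoℚ m) (ℕtoℚ n) ⟨
  ℚ.toℚᵘ (ℕtoℚ m + ℕtoℚ n)                  ∎)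
  where open ℚᵘₚ.≃-Reasoning

ℕtoℚ-* : ∀ m n → ℕtoℚ (m ℕ.* n) ≡ ℕtoℚ m * ℕtoℚ n
ℕtoℚ-* m n = ℚₚ.toℚᵘ-injective (begin
  ℚ.toℚᵘ (ℕtoℚ (m ℕ.* n))                   ≈⟨ toℚᵘ-ℕtoℚ (m ℕ.* n) ⟩
  ℕtoℚᵘ (m ℕ.* n)                           ≈⟨ *≡* (cong (ℤ._* ℤ.+ 1) (ℤₚ.pos-* m n)) ⟩
  ℕtoℚᵘ m ℚᵘ.* ℕtoℚᵘ n                      ≈⟨ ℚᵘₚ.*-cong (toℚᵘ-ℕtoℚ m) (toℚᵘ-ℕtoℚ n) ⟨
  ℚ.toℚᵘ (ℕtoℚ m) ℚᵘ.* ℚ.toℚᵘ (ℕtoℚ n)       ≈⟨ ℚₚ.toℚᵘ-homo-* (ℕtoℚ m) (ℕtoℚ n) ⟨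
  ℚ.toℚᵘ (ℕtoℚ m * ℕtoℚ n)                  ∎)
  where open ℚᵘₚ.≃-Reasoning

ℕtoℚ-injective : ∀ {m n} → ℕtoℚ m ≡ ℕtoℚ n → m ≡ n
ℕtoℚ-injective {m} {n} qm≡qn
  with *≡* m≡n ← ℚᵘₚ.≃-trans (ℚᵘₚ.≃-sym (toℚᵘ-ℕtoℚ m)) (ℚᵘₚ.≃-trans (ℚₚ.toℚᵘ-cong qm≡qn) (toℚᵘ-ℕtoℚ n))
  = ℤₚ.+-injective (trans (sym (ℤₚ.*-identityʳ (ℤ.+ m))) (trans m≡n (ℤₚ.*-identityʳ (ℤ.+ n))))

1+AB<A+B+C² : ∀ A B C → A ℕ.* B ≡ 0 → 2 ℕ.≤ C ℕ.* C → 1 ℕ.+ A ℕ.* B ℕ.< A ℕ.+ B ℕ.+ C ℕ.* C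
1+AB<A+B+C² A B C AB≡0 2≤C² rewrite AB≡0 = ℕₚ.≤-trans 2≤C² (ℕₚ.m≤n+m (C ℕ.* C) (A ℕ.+ B))

A+B+C²<1+AB : ∀ t B → (2 ℕ.+ t) ℕ.* (2 ℕ.+ t) ℕ.≤ B →
  (3 ℕ.+ t) ℕ.* (3 ℕ.+ t) ℕ.+ B ℕ.+ (4 ℕ.+ t) ℕ.* (4 ℕ.+ t) ℕ.< 1 ℕ.+ (3 ℕ.+ t) ℕ.* (3 ℕ.+ t) ℕ.* B
A+B+C²<1+AB t B B≥ with ℕₚ.m≤n⇒∃[o]m+o≡n B≥
... | s , refl = subst (N ℕ.<_) (sym (surplus t s)) (s≤s (ℕₚ.m≤m+n N _))
  where
  N : ℕ
  N = (3 ℕ.+ t) ℕ.* (3 ℕ.+ t) ℕ.+ ((2 ℕ.+ t) ℕ.* (2 ℕ.+ t) ℕ.+ s) ℕ.+ (4 ℕ.+ t) ℕ.* (4 ℕ.+ t)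
  surplus : ∀ t s →
    1 ℕ.+ (3 ℕ.+ t) ℕ.* (3 ℕ.+ t) ℕ.* ((2 ℕ.+ t) ℕ.* (2 ℕ.+ t) ℕ.+ s) ≡
    suc ((3 ℕ.+ t) ℕ.* (3 ℕ.+ t) ℕ.+ ((2 ℕ.+ t) ℕ.* (2 ℕ.+ t) ℕ.+ s) ℕ.+ (4 ℕ.+ t) ℕ.* (4 ℕ.+ t)
         ℕ.+ (7 ℕ.+ t ℕ.* (42 ℕ.+ t ℕ.* (34 ℕ.+ t ℕ.* (10 ℕ.+ t))) ℕ.+ (2 ℕ.+ t) ℕ.* (4 ℕ.+ t) ℕ.* s))
  surplus = ℕ-Solver.solve-∀

pathDet-ℕ : ∀ X Y U D → pathDet 0ℚ (ℕtoℚ X) (ℕtoℚ Y) (ℕtoℚ U) (ℕtoℚ D) ≡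
  ℕtoℚ (1 ℕ.+ X ℕ.* X ℕ.* (Y ℕ.* Y ℕ.+ U ℕ.* U)) - ℕtoℚ (X ℕ.* X ℕ.+ (Y ℕ.* Y ℕ.+ U ℕ.* U) ℕ.+ D ℕ.* D)
pathDet-ℕ X Y U D = trans (expand x y u δ) (sym (cong₂ _-_ P≡ N≡))
  where
  x y u δ : ℚ
  x = ℕtoℚ X
  y = ℕtoℚ Y
  u = ℕtoℚ U
  δ = ℕtoℚ D
  A B : ℕ
  A = X ℕ.* X
  B = Y ℕ.* Y ℕ.+ U ℕ.* U
  expand : ∀ x y u δ → (1ℚ - 0ℚ * 0ℚ - x * x) * (1ℚ - y * y - u * u) - (δ - 0ℚ * u) * (δ - 0ℚ * u) ≡
                       (1ℚ + x * x * (y * y + u * u)) - (x * x + (y * y + u * u) + δ * δ)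
  expand = solve-∀ ℚ-ring
  A≡ : ℕtoℚ A ≡ x * x
  A≡ = ℕtoℚ-* X X
  B≡ : ℕtoℚ B ≡ y * y + u * u
  B≡ = trans (ℕtoℚ-+ (Y ℕ.* Y) (U ℕ.* U)) (cong₂ _+_ (ℕtoℚ-* Y Y) (ℕtoℚ-* U U))
  P≡ : ℕtoℚ (1 ℕ.+ A ℕ.* B) ≡ 1ℚ + x * x * (y * y + u * u)
  P≡ = trans (ℕtoℚ-+ 1 (A ℕ.* B)) (cong (1ℚ +_) (trans (ℕtoℚ-* A B) (cong₂ _*_ A≡ B≡)))
  N≡ : ℕtoℚ (A ℕ.+ B ℕ.+ D ℕ.* D) ≡ x * x + (y * y + u * u) + δ * δ
  N≡ = trans (ℕtoℚ-+ (A ℕ.+ B) (D ℕ.* D)) (cong₂ _+_ (trans (ℕtoℚ-+ A B) (cong₂ _+_ A≡ B≡)) (ℕtoℚ-* D D))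

private
  ZeroOr : ℚ → ℕ → Set
  ZeroOr x k = x ≡ 0ℚ ⊎ x ≡ ℕtoℚ k

  ZeroOrℕ : ℕ → ℕ → Set
  ZeroOrℕ X k = X ≡ 0 ⊎ X ≡ k

  ZeroOr⇒ℕ : ∀ {x k} → ZeroOr x k → ∃ λ X → ZeroOrℕ X k × x ≡ ℕtoℚ X
  ZeroOr⇒ℕ (inj₁ refl) = 0 , inj₁ refl , refl
  ZeroOr⇒ℕ {k = k} (inj₂ refl) = k , inj₂ refl , refl

pathDet-ℕ≢ : ∀ t {X Y U} → ZeroOrℕ X (3 ℕ.+ t) → ZeroOrℕ Y (3 ℕ.+ t) → ZeroOrℕ U (2 ℕ.+ t) →
  1 ℕ.+ X ℕ.* X ℕ.* (Y ℕ.* Y ℕ.+ U ℕ.* U) ≢ X ℕ.* X ℕ.+ (Y ℕ.* Y ℕ.+ U ℕ.* U) ℕ.+ (4 ℕ.+ t) ℕ.* (4 ℕ.+ t)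
pathDet-ℕ≢ t {Y = Y} {U} (inj₁ refl) _ _ =
  ℕₚ.<⇒≢ (1+AB<A+B+C² 0 (Y ℕ.* Y ℕ.+ U ℕ.* U) (4 ℕ.+ t) refl (s≤s (s≤s z≤n)))
pathDet-ℕ≢ t (inj₂ refl) (inj₁ refl) (inj₁ refl) =
  ℕₚ.<⇒≢ (1+AB<A+B+C² X² 0 (4 ℕ.+ t) (ℕₚ.*-zeroʳ X²) (s≤s (s≤s z≤n)))
  where
  X² : ℕ
  X² = (3 ℕ.+ t) ℕ.* (3 ℕ.+ t)
pathDet-ℕ≢ t (inj₂ refl) (inj₁ refl) (inj₂ refl) =
  ℕₚ.>⇒≢ (A+B+C²<1+AB t ((2 ℕ.+ t) ℕ.* (2 ℕ.+ t)) ℕₚ.≤-refl)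
pathDet-ℕ≢ t (inj₂ refl) (inj₂ refl) (inj₁ refl) =
  ℕₚ.>⇒≢ (A+B+C²<1+AB t (Y² ℕ.+ 0)
    (ℕₚ.≤-trans (ℕₚ.*-mono-≤ (ℕₚ.n≤1+n (2 ℕ.+ t)) (ℕₚ.n≤1+n (2 ℕ.+ t))) (ℕₚ.m≤m+n Y² 0)))
  where
  Y² : ℕ
  Y² = (3 ℕ.+ t) ℕ.* (3 ℕ.+ t)
pathDet-ℕ≢ t (inj₂ refl) (inj₂ refl) (inj₂ refl) =
  ℕₚ.>⇒≢ (A+B+C²<1+AB t (Y² ℕ.+ U²) (ℕₚ.m≤n+m U² Y²))
  where
  Y² U² : ℕ
  Y² = (3 ℕ.+ t) ℕ.* (3 ℕ.+ t)
  U² = (2 ℕ.+ t) ℕ.* (2 ℕ.+ t)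

pathDet≢0 : ∀ t {w x y u} → w ≡ 0ℚ ⊎ (t ≡ 0 × w ≡ ℕtoℚ 2) →
  ZeroOr x (3 ℕ.+ t) → ZeroOr y (3 ℕ.+ t) → ZeroOr u (2 ℕ.+ t) → pathDet w x y u (ℕtoℚ (4 ℕ.+ t)) ≢ 0ℚ
pathDet≢0 t (inj₁ refl) x∈ y∈ u∈ det≡0
  with X , X∈ , refl ← ZeroOr⇒ℕ x∈ | Y , Y∈ , refl ← ZeroOr⇒ℕ y∈ | U , U∈ , refl ← ZeroOr⇒ℕ u∈ =
  pathDet-ℕ≢ t X∈ Y∈ U∈ (ℕtoℚ-injective (x∙y⁻¹≈ε⇒x≈y _ _ (trans (sym (pathDet-ℕ X Y U (4 ℕ.+ t))) det≡0)))
pathDet≢0 .0 (inj₂ (refl , refl)) (inj₁ refl) (inj₁ refl) (inj₁ refl) ()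
pathDet≢0 .0 (inj₂ (refl , refl)) (inj₁ refl) (inj₁ refl) (inj₂ refl) ()
pathDet≢0 .0 (inj₂ (refl , refl)) (inj₁ refl) (inj₂ refl) (inj₁ refl) ()
pathDet≢0 .0 (inj₂ (refl , refl)) (inj₁ refl) (inj₂ refl) (inj₂ refl) ()
pathDet≢0 .0 (inj₂ (refl , refl)) (inj₂ refl) (inj₁ refl) (inj₁ refl) ()
pathDet≢0 .0 (inj₂ (refl , refl)) (inj₂ refl) (inj₁ refl) (inj₂ refl) ()
pathDet≢0 .0 (inj₂ (refl , refl)) (inj₂ refl) (inj₂ refl) (inj₁ refl) ()
pathDet≢0 .0 (inj₂ (refl , refl)) (inj₂ refl) (inj₂ refl) (inj₂ refl) ()

-- Walks, distances and eccentricities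

module _ {n} {G : SimpleGraph n} where

  _++ʷ_ : ∀ {u v w i j} → Walk G u v i → Walk G v w j → Walk G u w (i ℕ.+ j)
  nil      ++ʷ q = q
  cons e p ++ʷ q = cons e (p ++ʷ q)

  snoc : ∀ {u v w k} → Walk G u v k → Adj G v w → Walk G u w (suc k)
  snoc nil        e = cons e nil
  snoc (cons f p) e = cons f (snoc p e)

  unsnoc : ∀ {u v k} → Walk G u v (suc k) → ∃ λ w → Walk G u w k × Adj G w v
  unsnoc (cons e nil)        = _ , nil , e
  unsnoc (cons e (cons f p)) with w , q , g ← unsnoc (cons f p) = w , cons e q , g

  reverse : ∀ {u v k} → Walk G u v k → Walk G v u k
  reverse nil        = nil
  reverse (cons e p) = snoc (reverse p) (Adj-sym G e)

  Dist-refl : ∀ u → Dist G u u 0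
  Dist-refl u = nil , λ _ _ → z≤n

  Dist-sym : ∀ {u v k} → Dist G u v k → Dist G v u k
  Dist-sym (p , shortest) = reverse p , λ j q → shortest j (reverse q)

  Dist-unique : ∀ {u v k l} → Dist G u v k → Dist G u v l → k ≡ l
  Dist-unique (p , p-shortest) (q , q-shortest) = ℕₚ.≤-antisym (p-shortest _ q) (q-shortest _ p)

  Dist-infix : ∀ {a b p q i j l d} → Dist G a b d →
               Walk G a p i → Walk G p q j → Walk G q b l → i ℕ.+ j ℕ.+ l ≡ d → Dist G p q j
  Dist-infix {i = i} {j} {l} (_ , shortest) pre mid post refl = mid , λ j′ mid′ →
    ℕₚ.+-cancelˡ-≤ i j j′ (ℕₚ.+-cancelʳ-≤ l (i ℕ.+ j) (i ℕ.+ j′)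
      (subst (i ℕ.+ j ℕ.+ l ℕ.≤_) (sym (ℕₚ.+-assoc i j′ l)) (shortest _ (pre ++ʷ (mid′ ++ʷ post)))))

  Ecc-diametral : ∀ {d u v} → Diameter G d → Dist G u v d → Ecc G u d
  Ecc-diametral (_ , ≤d) duv = (_ , duv) , λ v k → ≤d _ v k

¬¬-boundedMax : ∀ {P : ℕ → Set} → P 0 → ∀ d → ¬ ¬ (∃ λ e → P e × ∀ k → k ℕ.≤ d → P k → k ℕ.≤ e)
¬¬-boundedMax p₀ zero = pure (0 , p₀ , λ { _ z≤n _ → z≤n })
  where open RawMonad ¬¬-Monad
¬¬-boundedMax {P} p₀ (suc d) = do
  no ¬p ← ¬¬-excluded-middle {A = P (suc d)}
    where yes p → pure (suc d , p , λ _ k≤1+d _ → k≤1+d)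
  e , pₑ , maximal ← ¬¬-boundedMax p₀ d
  pure (e , pₑ , λ k k≤1+d pₖ → maximal k (ℕ.s≤s⁻¹ (ℕₚ.≤∧≢⇒< k≤1+d λ { refl → ¬p pₖ })) pₖ)
  where open RawMonad ¬¬-Monad

-- Adjacency is not decidable, so eccentricities exist only up to double negation.
¬¬-Ecc : ∀ {n} {G : SimpleGraph n} {d} → Diameter G d → ∀ u → ¬ ¬ ∃ (Ecc G u)
¬¬-Ecc {G = G} {d} (_ , ≤d) u = do
  e , (v , duv) , maximal ← ¬¬-boundedMax {P = λ k → ∃ λ v → Dist G u v k} (u , Dist-refl u) d
  pure (e , (v , duv) , λ w k duw → maximal k (≤d u w k duw) (w , duw))
  where open RawMonad ¬¬-Monad

module _ {n} {G : SimpleGraph n} {E : Fin n → Fin n → ℚ} (isE : IsEccentricityMatrix G E)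
         {u v εᵤ εᵥ k} (eccᵤ : Ecc G u εᵤ) (eccᵥ : Ecc G v εᵥ) (duv : Dist G u v k) where

  private
    uv : (k ≡ εᵤ ⊓ εᵥ → E u v ≡ ℕtoℚ k) × (k ≢ εᵤ ⊓ εᵥ → E u v ≡ 0ℚ)
    uv = isE u v εᵤ εᵥ k eccᵤ eccᵥ duv
    vu : (k ≡ εᵥ ⊓ εᵤ → E v u ≡ ℕtoℚ k) × (k ≢ εᵥ ⊓ εᵤ → E v u ≡ 0ℚ)
    vu = isE v u εᵥ εᵤ k eccᵥ eccᵤ (Dist-sym duv)

  entry-zero : k ℕ.< εᵤ → k ℕ.< εᵥ → E u v ≡ 0ℚ
  entry-zero k<εᵤ k<εᵥ = proj₂ uv λ k≡min → ℕₚ.<-irrefl k≡min (ℕₚ.⊓-glb k<εᵤ k<εᵥ)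

  entry-cases : E u v ≡ 0ℚ ⊎ (k ≡ εᵤ ⊓ εᵥ × E u v ≡ ℕtoℚ k)
  entry-cases with k ℕₚ.≟ εᵤ ⊓ εᵥ
  ... | yes k≡min = inj₂ (k≡min , proj₁ uv k≡min)
  ... | no  k≢min = inj₁ (proj₂ uv k≢min)

  entry-sym : E v u ≡ E u v
  entry-sym with k ℕₚ.≟ εᵤ ⊓ εᵥ
  ... | yes k≡min = trans (proj₁ vu (trans k≡min (ℕₚ.⊓-comm εᵤ εᵥ))) (sym (proj₁ uv k≡min))
  ... | no  k≢min = trans (proj₂ vu (k≢min ∘ flip trans (ℕₚ.⊓-comm εᵥ εᵤ))) (sym (proj₂ uv k≢min))

-- v₀ v₁ v₂ ⋯ v₃ v₄ is a diametral path of length d = 4 + t.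
module DiametralPath {n} {G : SimpleGraph n} {t} (diam : Diameter G (4 ℕ.+ t))
  {v₀ v₁ v₂ v₃ v₄} (geo : Dist G v₀ v₄ (4 ℕ.+ t))
  (e₀₁ : Adj G v₀ v₁) (e₁₂ : Adj G v₁ v₂) (mid : Walk G v₂ v₃ (suc t)) (e₃₄ : Adj G v₃ v₄)
  {E : Fin n → Fin n → ℚ} (isE : IsEccentricityMatrix G E)
  {ε₁ ε₂ ε₃} (ecc₁ : Ecc G v₁ ε₁) (ecc₂ : Ecc G v₂ ε₂) (ecc₃ : Ecc G v₃ ε₃) where

  vs : Fin 5 → Fin n
  vs = v₀ ∷ v₁ ∷ v₂ ∷ v₃ ∷ v₄ ∷ []

  position : Fin 5 → ℕ
  position = 0 ∷ 1 ∷ 2 ∷ 3 ℕ.+ t ∷ 4 ℕ.+ t ∷ []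

  position-injective : ∀ i j → position i ≡ position j → i ≡ j
  position-injective = λ where
    0F 0F _ → refl ; 0F 1F () ; 0F 2F () ; 0F 3F () ; 0F 4F ()
    1F 0F () ; 1F 1F _ → refl ; 1F 2F () ; 1F 3F () ; 1F 4F ()
    2F 0F () ; 2F 1F () ; 2F 2F _ → refl ; 2F 3F () ; 2F 4F ()
    3F 0F () ; 3F 1F () ; 3F 2F () ; 3F 3F _ → refl ; 3F 4F ()
    4F 0F () ; 4F 1F () ; 4F 2F () ; 4F 3F () ; 4F 4F _ → refl

  dist₀ : ∀ i → Dist G v₀ (vs i) (position i)
  dist₀ 0F = Dist-refl v₀
  dist₀ 1F = Dist-infix geo nil (cons e₀₁ nil) (cons e₁₂ (snoc mid e₃₄)) refl
  dist₀ 2F = Dist-infix geo nil (cons e₀₁ (cons e₁₂ nil)) (snoc mid e₃₄) refl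
  dist₀ 3F = Dist-infix geo nil (cons e₀₁ (cons e₁₂ mid)) (cons e₃₄ nil) (ℕₚ.+-comm (3 ℕ.+ t) 1)
  dist₀ 4F = geo

  dist₁₂ : Dist G v₁ v₂ 1
  dist₁₂ = Dist-infix geo (cons e₀₁ nil) (cons e₁₂ nil) (snoc mid e₃₄) refl
  dist₁₃ : Dist G v₁ v₃ (2 ℕ.+ t)
  dist₁₃ = Dist-infix geo (cons e₀₁ nil) (cons e₁₂ mid) (cons e₃₄ nil) (cong suc (ℕₚ.+-comm (2 ℕ.+ t) 1))
  dist₁₄ : Dist G v₁ v₄ (3 ℕ.+ t)
  dist₁₄ = Dist-infix geo (cons e₀₁ nil) (cons e₁₂ (snoc mid e₃₄)) nil (cong suc (ℕₚ.+-identityʳ (3 ℕ.+ t)))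
  dist₂₃ : Dist G v₂ v₃ (1 ℕ.+ t)
  dist₂₃ = Dist-infix geo (cons e₀₁ (cons e₁₂ nil)) mid (cons e₃₄ nil)
             (cong (2 ℕ.+_) (ℕₚ.+-comm (1 ℕ.+ t) 1))
  dist₂₄ : Dist G v₂ v₄ (2 ℕ.+ t)
  dist₂₄ = Dist-infix geo (cons e₀₁ (cons e₁₂ nil)) (snoc mid e₃₄) nil
             (cong (2 ℕ.+_) (ℕₚ.+-identityʳ (2 ℕ.+ t)))
  dist₃₄ : Dist G v₃ v₄ 1
  dist₃₄ = Dist-infix geo (cons e₀₁ (cons e₁₂ mid)) (cons e₃₄ nil) nil
             (trans (ℕₚ.+-identityʳ (3 ℕ.+ t ℕ.+ 1)) (ℕₚ.+-comm (3 ℕ.+ t) 1))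

  vs-injective : Injective _≡_ _≡_ vs
  vs-injective {i} {j} vsᵢ≡vsⱼ = position-injective i j
    (Dist-unique (dist₀ i) (subst (λ v → Dist G v₀ v (position j)) (sym vsᵢ≡vsⱼ) (dist₀ j)))

  ε : Fin 5 → ℕ
  ε = 4 ℕ.+ t ∷ ε₁ ∷ ε₂ ∷ ε₃ ∷ 4 ℕ.+ t ∷ []

  ecc : ∀ i → Ecc G (vs i) (ε i)
  ecc 0F = Ecc-diametral diam geo
  ecc 1F = ecc₁
  ecc 2F = ecc₂
  ecc 3F = ecc₃
  ecc 4F = Ecc-diametral diam (Dist-sym geo)

  ε₁≥ : 3 ℕ.+ t ℕ.≤ ε₁
  ε₁≥ = proj₂ ecc₁ v₄ _ dist₁₄
  ε₂≥ : 2 ℕ.+ t ℕ.≤ ε₂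
  ε₂≥ = proj₂ ecc₂ v₄ _ dist₂₄
  ε₃≥ : 3 ℕ.+ t ℕ.≤ ε₃
  ε₃≥ = proj₂ ecc₃ v₀ _ (Dist-sym (dist₀ 3F))

  2≤ε : ∀ i → 2 ℕ.≤ ε i
  2≤ε 0F = s≤s (s≤s z≤n)
  2≤ε 1F = ℕₚ.≤-trans (s≤s (s≤s z≤n)) ε₁≥
  2≤ε 2F = proj₂ ecc₂ v₀ 2 (Dist-sym (dist₀ 2F))
  2≤ε 3F = ℕₚ.≤-trans (s≤s (s≤s z≤n)) ε₃≥
  2≤ε 4F = s≤s (s≤s z≤n)

  w x y u δ : ℚ
  w = E v₀ v₂
  x = E v₀ v₃
  y = E v₁ v₄
  u = E v₂ v₄
  δ = ℕtoℚ (4 ℕ.+ t)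

  private
    zero-entry : ∀ i j {k} → Dist G (vs i) (vs j) k → k ℕ.< ε i → k ℕ.< ε j → E (vs i) (vs j) ≡ 0ℚ
    zero-entry i j = entry-zero isE (ecc i) (ecc j)

    diagonal : ∀ i → E (vs i) (vs i) ≡ 0ℚ
    diagonal i = zero-entry i i (Dist-refl (vs i)) 0<εᵢ 0<εᵢ
      where
      0<εᵢ : 0 ℕ.< ε i
      0<εᵢ = ℕₚ.≤-trans (s≤s z≤n) (2≤ε i)

    adjacent : ∀ i j → Dist G (vs i) (vs j) 1 → E (vs i) (vs j) ≡ 0ℚ
    adjacent i j dᵢⱼ = zero-entry i j dᵢⱼ (2≤ε i) (2≤ε j)

    mirror : ∀ i j {k m} → Dist G (vs i) (vs j) k → E (vs i) (vs j) ≡ m → E (vs j) (vs i) ≡ m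
    mirror i j dᵢⱼ = trans (entry-sym isE (ecc i) (ecc j) dᵢⱼ)

  entries : ∀ i j → E (vs i) (vs j) ≡ pathMatrix w x y u δ i j
  entries 0F 0F = diagonal 0F
  entries 0F 1F = adjacent 0F 1F (dist₀ 1F)
  entries 0F 2F = refl
  entries 0F 3F = refl
  entries 0F 4F = proj₁ (isE v₀ v₄ _ _ _ (ecc 0F) (ecc 4F) geo) (sym (ℕₚ.⊓-idem (4 ℕ.+ t)))
  entries 1F 0F = mirror 0F 1F (dist₀ 1F) (entries 0F 1F)
  entries 1F 1F = diagonal 1F
  entries 1F 2F = adjacent 1F 2F dist₁₂
  entries 1F 3F = zero-entry 1F 3F dist₁₃ ε₁≥ ε₃≥
  entries 1F 4F = refl
  entries 2F 0F = mirror 0F 2F (dist₀ 2F) refl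
  entries 2F 1F = mirror 1F 2F dist₁₂ (entries 1F 2F)
  entries 2F 2F = diagonal 2F
  entries 2F 3F = zero-entry 2F 3F dist₂₃ ε₂≥ (ℕₚ.≤-trans (ℕₚ.n≤1+n (2 ℕ.+ t)) ε₃≥)
  entries 2F 4F = refl
  entries 3F 0F = mirror 0F 3F (dist₀ 3F) refl
  entries 3F 1F = mirror 1F 3F dist₁₃ (entries 1F 3F)
  entries 3F 2F = mirror 2F 3F dist₂₃ (entries 2F 3F)
  entries 3F 3F = diagonal 3F
  entries 3F 4F = adjacent 3F 4F dist₃₄
  entries 4F 0F = mirror 0F 4F geo (entries 0F 4F)
  entries 4F 1F = mirror 1F 4F dist₁₄ refl
  entries 4F 2F = mirror 2F 4F dist₂₄ refl
  entries 4F 3F = mirror 3F 4F dist₃₄ (entries 3F 4F)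
  entries 4F 4F = diagonal 4F

  -- A nonzero w means 2 = min (ε v₀) (ε v₂) ≥ d(v₂, v₄) = d - 2, so d = 4.
  w∈ : w ≡ 0ℚ ⊎ (t ≡ 0 × w ≡ ℕtoℚ 2)
  w∈ = map₂ (λ (2≡min , w≡2) → t≡0 2≡min , w≡2) (entry-cases isE (ecc 0F) (ecc 2F) (dist₀ 2F))
    where
    t≡0 : 2 ≡ (4 ℕ.+ t) ⊓ ε₂ → t ≡ 0
    t≡0 2≡min = ℕₚ.n≤0⇒n≡0 (ℕₚ.+-cancelˡ-≤ 2 t 0 (subst (2 ℕ.+ t ℕ.≤_) (sym 2≡min)
      (ℕₚ.⊓-glb (ℕₚ.≤-trans (ℕₚ.n≤1+n (2 ℕ.+ t)) (ℕₚ.n≤1+n (3 ℕ.+ t))) ε₂≥)))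

  principal-regular : ∀ g → InEigenspace (λ i j → E (vs i) (vs j)) (- 1ℚ) g → ∀ i → g i ≡ 0ℚ
  principal-regular g eig = pathMatrix-regular det≢0 g λ i →
    trans (∑-cong (λ j → cong (_* g j) (sym (entries i j)))) (eig i)
    where
    det≢0 : pathDet w x y u δ ≢ 0ℚ
    det≢0 = pathDet≢0 t w∈
      (map₂ proj₂ (entry-cases isE (ecc 0F) (ecc 3F) (dist₀ 3F)))
      (map₂ proj₂ (entry-cases isE (ecc 1F) (ecc 4F) dist₁₄))
      (map₂ proj₂ (entry-cases isE (ecc 2F) (ecc 4F) dist₂₄))

  dim+5≤n : ∀ {k} → EigenspaceDimAtLeast E (- 1ℚ) k → k ℕ.+ 5 ℕ.≤ n
  dim+5≤n = eigenspaceDim+m≤n vs-injective E (- 1ℚ) principal-regular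

lemma3p5 : (n : ℕ) (G : SimpleGraph n) (d : ℕ) (E : Fin n → Fin n → ℚ) →
    Connected G → Diameter G d → 4 ℕ.≤ d → IsEccentricityMatrix G E →
    MultiplicityAtMost E (- 1ℚ) (n ∸ 5)
lemma3p5 n G _ E _ diam@((v₀ , v₄ , geo@(cons e₀₁ (cons e₁₂ rest) , _)) , _) (s≤s (s≤s (s≤s (s≤s z≤n))))
         isE k dim with v₃ , mid , e₃₄ ← unsnoc rest =
  ℕₚ.m+n≤o⇒m≤o∸n k (decidable-stable (k ℕ.+ 5 ℕₚ.≤? n) do
    ε₁ , ecc₁ ← ¬¬-Ecc diam _
    ε₂ , ecc₂ ← ¬¬-Ecc diam _
    ε₃ , ecc₃ ← ¬¬-Ecc diam v₃
    pure (DiametralPath.dim+5≤n diam geo e₀₁ e₁₂ mid e₃₄ isE ecc₁ ecc₂ ecc₃ dim))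
  where open RawMonad ¬¬-Monad
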